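{- Let $B$ be a binary string with block partition $B=B_1B_2\cdots B_t$ and $|B|=n$. For any zero forcing set $S$ of the threshold graph $T(B)$, there is a set of block indices $A\subseteq\{1,\ldots,t\}$ and a corresponding set of symbol indices $J=\{j_i\in\{1,\ldots,|B_i|\}: i\in A\}$ that uniquely identifies $S$: namely, $S$ is the set of size $n-|A|$ containing all vertices except the $j_i$-th vertex of block $B_i$ for each $i\in A$.
   Context: For a binary string $B=b_1b_2\cdots b_n$, the threshold graph $T(B)$ has vertex set the positions $1,\ldots,n$ of $B$, with positions $p<q$ adjacent if and only if $b_q=1$. Standing assumptions: $b_1=b_2$ and $b_n=1$. A block of $B$ is a maximal contiguous substring consisting only of 0s or only of 1s; the block partition $B=B_1\cdots B_t$ lists the blocks from left to right. Zero forcing: a colored vertex with exactly one uncolored neighbor may force that neighbor to become colored; $S$ is a zero forcing set if starting with $S$ colored and repeatedly applying this rule colors all vertices. -}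

module Defs where

open import Data.Nat using (ℕ; zero; suc; _+_; _<_)
open import Data.Bool using (Bool; true; false; _≟_)
open import Data.List using (List; []; _∷_; length; lookup; _∷ʳ_; take)
open import Data.Nat.ListAction using (sum)
open import Data.Fin using (Fin; toℕ)
open import Data.Fin.Subset using (Subset; _∈_)
open import Data.Product using (Σ; _×_)
open import Data.Sum using (_⊎_)
open import Relation.Binary.PropositionalEquality using (_≡_; _≢_)
open import Relation.Nullary using (yes; no)

Standing : List Bool → Set
Standing B = (Σ Bool λ b → Σ (List Bool) λ bs → B ≡ b ∷ b ∷ bs)
           × (Σ (List Bool) λ bs → B ≡ bs ∷ʳ true)

Vertex : List Bool → Set
Vertex B = Fin (length B)

Adj : (B : List Bool) → Vertex B → Vertex B → Set
Adj B p q = (toℕ p < toℕ q × lookup B q ≡ true)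
          ⊎ (toℕ q < toℕ p × lookup B p ≡ true)

-- Vertices eventually colored by the zero forcing process starting from S
-- (least set containing S and closed under the forcing rule).
data Colored (B : List Bool) (S : Subset (length B)) : Vertex B → Set where
  initial : ∀ {v} → v ∈ S → Colored B S v
  force   : ∀ {u v} → Colored B S u → Adj B u v →
            (∀ w → Adj B u w → w ≢ v → Colored B S w) →
            Colored B S v

ZeroForcingSet : (B : List Bool) → Subset (length B) → Set
ZeroForcingSet B S = ∀ v → Colored B S v

-- Block partition: list of lengths of the maximal constant runs, left to right.
private
  incHead : List ℕ → List ℕ
  incHead []       = []
  incHead (k ∷ ks) = suc k ∷ ks

runsFrom : Bool → List Bool → List ℕ
runsFrom b []       = 1 ∷ []
runsFrom b (c ∷ bs) with b ≟ c
... | yes _ = incHead (runsFrom c bs)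
... | no  _ = 1 ∷ runsFrom c bs

blockLengths : List Bool → List ℕ
blockLengths []       = []
blockLengths (b ∷ bs) = runsFrom b bs

numBlocks : List Bool → ℕ
numBlocks B = length (blockLengths B)

blockLen : (B : List Bool) → Fin (numBlocks B) → ℕ
blockLen B i = lookup (blockLengths B) i

blockStart : (B : List Bool) → Fin (numBlocks B) → ℕ
blockStart B i = sum (take (toℕ i) (blockLengths B))

-- Two distinct vertices in the same block of B are twins in T(B): apart from
-- each other they have the same neighbours, because adjacency of p < q only
-- depends on the symbol at q and all symbols of a block agree.  A vertex
-- adjacent to one of two uncolored twins is adjacent to the other, so it
-- never has a unique uncolored neighbour among them; hence two uncolored
-- twins stay uncolored forever.  Consequently a zero forcing set S misses at
-- most one vertex of every block.
--
-- The rest is pure bookkeeping about a list L of block lengths: a subset of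
-- the n = sum L positions missing at most one position per block is the
-- complement of a set of "holes", one at an offset J i in each block i of
-- some set A of blocks, and then |S| + |A| = n.
module Submission where

open import Defs
open import Data.Nat using (ℕ; zero; suc; _+_; _≤_; _<_; z≤n; s≤s)
open import Data.Nat.Properties
  using (≤-trans; ≤-<-trans; <⇒≤; <-cmp; ≤⇒≯; m≤m+n; +-assoc; +-suc;
         +-cancelˡ-≡; +-monoʳ-≤; +-monoʳ-<; +-commutativeSemigroup)
open import Data.Nat.ListAction using (sum)
open import Data.Bool using (Bool; true; false) renaming (_≟_ to _≟ᴮ_)
open import Data.Maybe using (Maybe; just; nothing; is-just)
open import Data.List using (List; []; _∷_; length; lookup; take)
open import Data.Vec using ([]; _∷_; _++_; splitAt; here; there)
open import Data.Fin using (Fin; zero; suc; toℕ; _↑ˡ_; _↑ʳ_) renaming (_≟_ to _≟ᶠ_)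
open import Data.Fin.Properties
  using (toℕ-injective; toℕ<n; toℕ-↑ˡ; toℕ-↑ʳ; ↑ˡ-injective; ↑ʳ-injective; suc-injective; 0≢1+n)
open import Data.Fin.Subset.Properties using (drop-there)
open import Data.Fin.Subset using (Subset; _∈_; _∉_; ∣_∣)
open import Data.Product using (Σ; ∃; _×_; _,_; proj₁; proj₂)
open import Data.Sum using (inj₁; inj₂)
open import Data.Empty using (⊥-elim)
open import Function.Base using (id; _∘_)
open import Function.Bundles using (_⇔_; mk⇔; Equivalence)
open import Function.Construct.Symmetry using (⇔-sym)
open import Function.Related.Propositional using (module EquationalReasoning)
open import Function.Related.TypeIsomorphisms using (¬-cong-⇔)
open import Algebra.Properties.CommutativeSemigroup +-commutativeSemigroup using (interchange)
open import Relation.Binary.PropositionalEquality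
  using (_≡_; _≢_; refl; sym; trans; cong; cong₂; subst; ≢-sym; module ≡-Reasoning)
open import Relation.Binary.Definitions using (tri<; tri≈; tri>)
open import Relation.Nullary using (¬_; yes; no)

SharesNeighbours : (B : List Bool) → Vertex B → Vertex B → Set
SharesNeighbours B p q = ∀ u → u ≢ q → Adj B u p → Adj B u q

-- Two distinct uncolored twins p, q are never colored: a vertex u that could
-- force one of them is adjacent to both, and the other is still uncolored.
module _ {B : List Bool} {S : Subset (length B)} {p q : Vertex B}
         (p≢q : p ≢ q) (p~q : SharesNeighbours B p q) (q~p : SharesNeighbours B q p)
         (p∉S : p ∉ S) (q∉S : q ∉ S) where

  twins-stay-uncolored : ∀ {w} → Colored B S w → w ≢ p × w ≢ q
  twins-stay-uncolored (initial w∈S) = (λ { refl → p∉S w∈S }) , (λ { refl → q∉S w∈S })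
  twins-stay-uncolored (force {u} {v} u-colored u-v others)
    with twins-stay-uncolored u-colored
  ... | u≢p , u≢q = v≢p , v≢q
    where
    v≢p : v ≢ p
    v≢p refl = proj₂ (twins-stay-uncolored (others q (p~q u u≢q u-v) (≢-sym p≢q))) refl
    v≢q : v ≢ q
    v≢q refl = proj₁ (twins-stay-uncolored (others p (q~p u u≢p u-v) p≢q)) refl

Interval : ℕ → ℕ → ℕ → Set
Interval s len r = s ≤ r × r < s + len

-- Symbol of B at position r (false beyond the end); lets us reason about
-- positions as plain numbers.
nth : List Bool → ℕ → Bool
nth []       _       = false
nth (x ∷ xs) zero    = x
nth (x ∷ xs) (suc r) = nth xs r

lookup≡nth : ∀ xs (q : Fin (length xs)) → lookup xs q ≡ nth xs (toℕ q)
lookup≡nth (x ∷ xs) zero    = refl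
lookup≡nth (x ∷ xs) (suc q) = lookup≡nth xs q

-- If B is constant on the interval [s, s + len), then any two positions p, q
-- of that interval are twins in T(B).  For a third vertex u, adjacency to p
-- or q is decided by the symbol at the larger of the two endpoints, and that
-- symbol is either b_u or a symbol of the interval.
module ConstantStretch (B : List Bool) (s len : ℕ)
       (constant : ∀ r → Interval s len r → nth B r ≡ nth B s) where

  symbol : ∀ (x : Vertex B) → Interval s len (toℕ x) → lookup B x ≡ nth B s
  symbol x x∈I = trans (lookup≡nth B x) (constant (toℕ x) x∈I)

  between : ∀ {a b r} → Interval s len a → Interval s len b → a < r → r < b → Interval s len r
  between (s≤a , _) (_ , b<end) a<r r<b = ≤-trans s≤a (<⇒≤ a<r) , ≤-<-trans (<⇒≤ r<b) b<end

  stretch-twins : ∀ p q → Interval s len (toℕ p) → Interval s len (toℕ q) → SharesNeighbours B p q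
  stretch-twins p q p∈I q∈I u u≢q (inj₁ (u<p , bp)) with <-cmp (toℕ u) (toℕ q)
  ... | tri< u<q _ _ = inj₁ (u<q , trans (symbol q q∈I) (trans (sym (symbol p p∈I)) bp))
  ... | tri≈ _ u≡q _ = ⊥-elim (u≢q (toℕ-injective u≡q))
  ... | tri> _ _ q<u = inj₂ (q<u , trans (symbol u (between q∈I p∈I q<u u<p)) (trans (sym (symbol p p∈I)) bp))
  stretch-twins p q p∈I q∈I u u≢q (inj₂ (p<u , bu)) with <-cmp (toℕ u) (toℕ q)
  ... | tri< u<q _ _ = inj₁ (u<q , trans (symbol q q∈I) (trans (sym (symbol u (between p∈I q∈I p<u u<q))) bu))
  ... | tri≈ _ u≡q _ = ⊥-elim (u≢q (toℕ-injective u≡q))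
  ... | tri> _ _ q<u = inj₂ (q<u , bu)

start : (L : List ℕ) → Fin (length L) → ℕ
start L i = sum (take (toℕ i) L)

InBlock : (L : List ℕ) → Fin (length L) → ℕ → Set
InBlock L i = Interval (start L i) (lookup L i)

ConstantBlocks : List ℕ → List Bool → Set
ConstantBlocks L xs = ∀ i r → InBlock L i r → nth xs r ≡ nth xs (start L i)

runs-constant : ∀ b bs → ConstantBlocks (runsFrom b bs) (b ∷ bs)
runs-constant b [] zero zero    _          = refl
runs-constant b [] zero (suc r) (_ , s≤s ())
runs-constant b (c ∷ bs) with b ≟ᴮ c
... | yes refl with runsFrom b bs | runs-constant b bs
...   | []     | _  = λ ()
...   | k ∷ ks | ih = extended
  where
  extended : ConstantBlocks (suc k ∷ ks) (b ∷ b ∷ bs)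
  extended zero    zero    _                  = refl
  extended zero    (suc r) (_ , s≤s r<k)      = ih zero r (z≤n , r<k)
  extended (suc i) zero    (() , _)
  extended (suc i) (suc r) (s≤s s≤r , s≤s r<e) = ih (suc i) r (s≤r , r<e)
runs-constant b (c ∷ bs) | no _ = prepended
  where
  prepended : ConstantBlocks (1 ∷ runsFrom c bs) (b ∷ c ∷ bs)
  prepended zero    zero    _                  = refl
  prepended zero    (suc r) (_ , s≤s ())
  prepended (suc i) zero    (() , _)
  prepended (suc i) (suc r) (s≤s s≤r , s≤s r<e) = runs-constant c bs i r (s≤r , r<e)

blocks-constant : ∀ B → ConstantBlocks (blockLengths B) B
blocks-constant []       ()
blocks-constant (b ∷ bs) = runs-constant b bs

runs-sum : ∀ b bs → sum (runsFrom b bs) ≡ suc (length bs)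
runs-sum b [] = refl
runs-sum b (c ∷ bs) with b ≟ᴮ c
... | yes _ with runsFrom c bs | runs-sum c bs
...   | []     | ()
...   | k ∷ ks | ih = cong suc ih
runs-sum b (c ∷ bs) | no _ = cong suc (runs-sum c bs)

blocks-sum : ∀ B → sum (blockLengths B) ≡ length B
blocks-sum []       = refl
blocks-sum (b ∷ bs) = runs-sum b bs

data Split (l m : ℕ) : Fin (l + m) → Set where
  first  : (j : Fin l) → Split l m (j ↑ˡ m)
  second : (k : Fin m) → Split l m (l ↑ʳ k)

split : ∀ l m (v : Fin (l + m)) → Split l m v
split zero    m v       = second v
split (suc l) m zero    = first zero
split (suc l) m (suc v) with split l m v
... | first j  = first (suc j)
... | second k = second k

∈-↑ˡ : ∀ {l m} (xs : Subset l) (ys : Subset m) j → (j ↑ˡ m) ∈ xs ++ ys ⇔ j ∈ xs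
∈-↑ˡ (x ∷ xs) ys zero    = mk⇔ (λ { here → here }) (λ { here → here })
∈-↑ˡ (x ∷ xs) ys (suc j) = mk⇔ (λ { (there p) → there (Equivalence.to (∈-↑ˡ xs ys j) p) })
                               (λ { (there p) → there (Equivalence.from (∈-↑ˡ xs ys j) p) })

∈-↑ʳ : ∀ {l m} (xs : Subset l) (ys : Subset m) k → (l ↑ʳ k) ∈ xs ++ ys ⇔ k ∈ ys
∈-↑ʳ []       ys k = mk⇔ id id
∈-↑ʳ (x ∷ xs) ys k = mk⇔ (λ { (there p) → Equivalence.to (∈-↑ʳ xs ys k) p })
                         (λ p → there (Equivalence.from (∈-↑ʳ xs ys k) p))

∣++∣ : ∀ {l m} (xs : Subset l) (ys : Subset m) → ∣ xs ++ ys ∣ ≡ ∣ xs ∣ + ∣ ys ∣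
∣++∣ []           ys = refl
∣++∣ (true  ∷ xs) ys = cong suc (∣++∣ xs ys)
∣++∣ (false ∷ xs) ys = ∣++∣ xs ys

record Holes (L : List ℕ) : Set where
  constructor holes
  field
    blocks : Subset (length L)
    offset : (i : Fin (length L)) → i ∈ blocks → Fin (lookup L i)
open Holes

IsHole : (L : List ℕ) → Holes L → ℕ → Set
IsHole L (holes A J) r = ∃ λ i → Σ (i ∈ A) λ i∈A → r ≡ start L i + toℕ (J i i∈A)

Describes : (L : List ℕ) {n : ℕ} → Subset n → Holes L → Set
Describes L {n} S H = (∀ v → v ∈ S ⇔ (¬ IsHole L H (toℕ v))) × (∣ S ∣ + ∣ blocks H ∣ ≡ n)

AtMostOneMissing : (L : List ℕ) {n : ℕ} → Subset n → Set
AtMostOneMissing L {n} S = ∀ i (p q : Fin n) → InBlock L i (toℕ p) → InBlock L i (toℕ q) →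
                           p ∉ S → q ∉ S → p ≡ q

hole-offset : ∀ {l n} {A : Subset n} (h : Maybe (Fin l)) → zero ∈ is-just h ∷ A → Fin l
hole-offset (just j) _ = j
hole-offset nothing  ()

_∷ʰ_ : ∀ {l L} → Maybe (Fin l) → Holes L → Holes (l ∷ L)
_∷ʰ_ {l} {L} h (holes A J) = holes (is-just h ∷ A) J′
  where
  J′ : (i : Fin (suc (length L))) → i ∈ is-just h ∷ A → Fin (lookup (l ∷ L) i)
  J′ zero    i∈A         = hole-offset h i∈A
  J′ (suc i) (there i∈A) = J i i∈A

holeCount : ∀ {l} → Maybe (Fin l) → ℕ
holeCount nothing  = 0
holeCount (just _) = 1

∣∷ʰ∣ : ∀ {l L} (h : Maybe (Fin l)) (H : Holes L) → ∣ blocks (h ∷ʰ H) ∣ ≡ holeCount h + ∣ blocks H ∣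
∣∷ʰ∣ nothing  (holes A J) = refl
∣∷ʰ∣ (just _) (holes A J) = refl

offset-below : ∀ {l} (j : Fin l) {r} → l ≤ r → toℕ j ≢ r
offset-below j l≤r refl = ≤⇒≯ l≤r (toℕ<n j)

hole-first-block : ∀ {l L} (h : Maybe (Fin l)) (H : Holes L) (j : Fin l) →
                   IsHole (l ∷ L) (h ∷ʰ H) (toℕ j) ⇔ h ≡ just j
hole-first-block {l} {L} h (holes A J) j = mk⇔ to from
  where
  at-offset : ∀ h (i∈A : zero ∈ is-just h ∷ A) → toℕ j ≡ toℕ (hole-offset h i∈A) → h ≡ just j
  at-offset (just k) _ j≡k = cong just (toℕ-injective (sym j≡k))

  to : IsHole (l ∷ L) (h ∷ʰ (holes A J)) (toℕ j) → h ≡ just j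
  to (zero    , i∈A       , j≡hole) = at-offset h i∈A j≡hole
  to (suc i   , there i∈A , j≡hole) =
    ⊥-elim (offset-below j (≤-trans (m≤m+n l (start L i)) (m≤m+n _ _)) j≡hole)

  from : h ≡ just j → IsHole (l ∷ L) (h ∷ʰ (holes A J)) (toℕ j)
  from refl = zero , here , refl

hole-later-blocks : ∀ {l L} (h : Maybe (Fin l)) (H : Holes L) (k : ℕ) →
                    IsHole (l ∷ L) (h ∷ʰ H) (l + k) ⇔ IsHole L H k
hole-later-blocks {l} {L} h (holes A J) k = mk⇔ to from
  where
  to : IsHole (l ∷ L) (h ∷ʰ (holes A J)) (l + k) → IsHole L (holes A J) k
  to (zero  , i∈A       , e) = ⊥-elim (offset-below (hole-offset h i∈A) (m≤m+n l k) (sym e))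
  to (suc i , there i∈A , e) = i , i∈A , +-cancelˡ-≡ l _ _ (trans e (+-assoc l _ _))

  from : IsHole L (holes A J) k → IsHole (l ∷ L) (h ∷ʰ (holes A J)) (l + k)
  from (i , i∈A , e) = suc i , there i∈A , trans (cong (l +_) e) (sym (+-assoc l _ _))

MissesAtMostOne : ∀ {l} → Subset l → Set
MissesAtMostOne xs = ∀ j k → j ∉ xs → k ∉ xs → j ≡ k

misses-tail : ∀ {l x} {xs : Subset l} → MissesAtMostOne (x ∷ xs) → MissesAtMostOne xs
misses-tail unique j k j∉xs k∉xs =
  suc-injective (unique (suc j) (suc k) (j∉xs ∘ drop-there) (k∉xs ∘ drop-there))

OneHole : ∀ {l} → Subset l → Maybe (Fin l) → Set
OneHole {l} xs h = (∀ j → j ∈ xs ⇔ h ≢ just j) × (∣ xs ∣ + holeCount h ≡ l)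

-- A block missing at most one position has one optional hole, found by
-- induction on the block: a missing head becomes the hole, and then the
-- tail can miss nothing.
one-hole : ∀ {l} (xs : Subset l) → MissesAtMostOne xs → Σ (Maybe (Fin l)) (OneHole xs)
one-hole []          _      = nothing , (λ ()) , refl
one-hole (true ∷ xs) unique with one-hole xs (misses-tail unique)
... | nothing , members , count = nothing , members′ , cong suc count
  where
  members′ : ∀ j → j ∈ true ∷ xs ⇔ nothing ≢ just j
  members′ zero    = mk⇔ (λ _ ()) (λ _ → here)
  members′ (suc j) = mk⇔ (λ _ ()) (λ _ → there (Equivalence.from (members j) λ ()))
... | just j₀ , members , count = just (suc j₀) , members′ , cong suc count
  where
  members′ : ∀ j → j ∈ true ∷ xs ⇔ just (suc j₀) ≢ just j
  members′ zero    = mk⇔ (λ _ ()) (λ _ → here)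
  members′ (suc j) = mk⇔ (λ { (there j∈xs) refl → Equivalence.to (members j) j∈xs refl })
                         (λ j≢j₀ → there (Equivalence.from (members j) λ { refl → j≢j₀ refl }))
one-hole (false ∷ xs) unique with one-hole xs (misses-tail unique)
... | nothing , members , count = just zero , members′ , trans (+-suc ∣ xs ∣ 0) (cong suc count)
  where
  members′ : ∀ j → j ∈ false ∷ xs ⇔ just zero ≢ just j
  members′ zero    = mk⇔ (λ ()) (λ 0≢0 → ⊥-elim (0≢0 refl))
  members′ (suc j) = mk⇔ (λ _ ()) (λ _ → there (Equivalence.from (members j) λ ()))
... | just j₀ , members , _ = ⊥-elim (0≢1+n (unique zero (suc j₀) (λ ()) suc-j₀-missing))
  where
  suc-j₀-missing : suc j₀ ∉ false ∷ xs
  suc-j₀-missing (there j₀∈xs) = Equivalence.to (members j₀) j₀∈xs refl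

describes-++ : ∀ {l L} (xs : Subset l) (ys : Subset (sum L)) (h : Maybe (Fin l)) (H : Holes L) →
               OneHole xs h → Describes L ys H → Describes (l ∷ L) (xs ++ ys) (h ∷ʰ H)
describes-++ {l} {L} xs ys h H (xs-members , xs-count) (ys-members , ys-count) = members , count
  where
  NotHole : ℕ → Set
  NotHole r = ¬ IsHole (l ∷ L) (h ∷ʰ H) r

  members : ∀ v → v ∈ xs ++ ys ⇔ NotHole (toℕ v)
  members v with split l (sum L) v
  ... | first j = begin
    (j ↑ˡ sum L) ∈ xs ++ ys     ∼⟨ ∈-↑ˡ xs ys j ⟩
    j ∈ xs                      ∼⟨ xs-members j ⟩
    h ≢ just j                  ∼⟨ ¬-cong-⇔ (⇔-sym (hole-first-block h H j)) ⟩
    NotHole (toℕ j)             ≡⟨ cong NotHole (sym (toℕ-↑ˡ j (sum L))) ⟩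
    NotHole (toℕ (j ↑ˡ sum L))  ∎
    where open EquationalReasoning
  ... | second k = begin
    (l ↑ʳ k) ∈ xs ++ ys         ∼⟨ ∈-↑ʳ xs ys k ⟩
    k ∈ ys                      ∼⟨ ys-members k ⟩
    ¬ IsHole L H (toℕ k)        ∼⟨ ¬-cong-⇔ (⇔-sym (hole-later-blocks h H (toℕ k))) ⟩
    NotHole (l + toℕ k)         ≡⟨ cong NotHole (sym (toℕ-↑ʳ l k)) ⟩
    NotHole (toℕ (l ↑ʳ k))      ∎
    where open EquationalReasoning

  count : ∣ xs ++ ys ∣ + ∣ blocks (h ∷ʰ H) ∣ ≡ l + sum L
  count = begin
    ∣ xs ++ ys ∣ + ∣ blocks (h ∷ʰ H) ∣               ≡⟨ cong₂ _+_ (∣++∣ xs ys) (∣∷ʰ∣ h H) ⟩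
    (∣ xs ∣ + ∣ ys ∣) + (holeCount h + ∣ blocks H ∣) ≡⟨ interchange (∣ xs ∣) (∣ ys ∣) (holeCount h) (∣ blocks H ∣) ⟩
    (∣ xs ∣ + holeCount h) + (∣ ys ∣ + ∣ blocks H ∣) ≡⟨ cong₂ _+_ xs-count ys-count ⟩
    l + sum L                                        ∎
    where open ≡-Reasoning

shift-interval : ∀ l {s len r} → Interval s len r → Interval (l + s) len (l + r)
shift-interval l {s} {len} {r} (s≤r , r<end) =
  +-monoʳ-≤ l s≤r , subst (l + r <_) (sym (+-assoc l s len)) (+-monoʳ-< l r<end)

module _ {l L} (xs : Subset l) (ys : Subset (sum L))
         (unique : AtMostOneMissing (l ∷ L) (xs ++ ys)) where

  first-block-unique : MissesAtMostOne xs
  first-block-unique j k j∉xs k∉xs = ↑ˡ-injective (sum L) j k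
    (unique zero (j ↑ˡ sum L) (k ↑ˡ sum L) (in-first j) (in-first k)
            (j∉xs ∘ Equivalence.to (∈-↑ˡ xs ys j)) (k∉xs ∘ Equivalence.to (∈-↑ˡ xs ys k)))
    where
    in-first : ∀ j → InBlock (l ∷ L) zero (toℕ (j ↑ˡ sum L))
    in-first j = z≤n , subst (_< l) (sym (toℕ-↑ˡ j (sum L))) (toℕ<n j)

  later-blocks-unique : AtMostOneMissing L ys
  later-blocks-unique i p q p∈i q∈i p∉ys q∉ys = ↑ʳ-injective l p q
    (unique (suc i) (l ↑ʳ p) (l ↑ʳ q) (shifted p p∈i) (shifted q q∈i)
            (p∉ys ∘ Equivalence.to (∈-↑ʳ xs ys p)) (q∉ys ∘ Equivalence.to (∈-↑ʳ xs ys q)))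
    where
    shifted : ∀ p → InBlock L i (toℕ p) → InBlock (l ∷ L) (suc i) (toℕ (l ↑ʳ p))
    shifted p p∈i = subst (InBlock (l ∷ L) (suc i)) (sym (toℕ-↑ʳ l p)) (shift-interval l p∈i)

describe : ∀ L {n} → sum L ≡ n → (S : Subset n) → AtMostOneMissing L S → Σ (Holes L) (Describes L S)
describe []      refl []    _      = holes [] (λ ()) , (λ ()) , refl
describe (l ∷ L) refl S     unique with splitAt l S
... | xs , ys , refl with one-hole xs (first-block-unique xs ys unique)
                        | describe L refl ys (later-blocks-unique xs ys unique)
...   | h , xs-hole | H , ys-described = h ∷ʰ H , describes-++ xs ys h H xs-hole ys-described

-- A zero forcing set of T(B) misses at most one vertex of each block: two
-- missed vertices of one block would be uncolored twins, never colored.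
zero-forcing-misses-one : ∀ B (S : Subset (length B)) → ZeroForcingSet B S →
                          AtMostOneMissing (blockLengths B) S
zero-forcing-misses-one B S forcing i p q p∈i q∈i p∉S q∉S with p ≟ᶠ q
... | yes p≡q = p≡q
... | no  p≢q = ⊥-elim (proj₁ (twins-stay-uncolored p≢q (stretch-twins p q p∈i q∈i)
                                 (stretch-twins q p q∈i p∈i) p∉S q∉S (forcing p)) refl)
  where
  open ConstantStretch B (start (blockLengths B) i) (lookup (blockLengths B) i) (blocks-constant B i)

-- Corollary 4.9: a zero forcing set is all of T(B) except one chosen vertex
-- in each block of a set A of blocks.
corollary4p9 : (B : List Bool) → Standing B →
    (S : Subset (length B)) → ZeroForcingSet B S →
    Σ (Subset (numBlocks B)) λ A →
    Σ ((i : Fin (numBlocks B)) → i ∈ A → Fin (blockLen B i)) λ J →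
      (∀ (v : Vertex B) →
        (v ∈ S ⇔ (¬ (∃ λ i → Σ (i ∈ A) λ i∈A → toℕ v ≡ blockStart B i + toℕ (J i i∈A)))))
      × (∣ S ∣ + ∣ A ∣ ≡ length B)
corollary4p9 B _ S forcing
  with describe (blockLengths B) (blocks-sum B) S (zero-forcing-misses-one B S forcing)
... | holes A J , described = A , J , described
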